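{- Let $S_\infty$ be a set with subsets $S_1\subseteq S_2\subseteq\cdots$, $S_\infty=\bigcup_nS_n$, and let $((\mathrm{cl}_n)_{n\ge1},\mathrm{cl}_\infty)$ be a consistent system of closure operations. Let $\mathcal A=(A_n)_{n\ge1}$ be a $(\mathrm{cl}_n)$-closed chain with limit $A_\infty$ and saturation $\bar{\mathcal A}=(A_\infty\cap S_n)_{n\ge1}$. Then the following are equivalent: (i) $A_\infty$ is $\mathrm{cl}_\infty$-closed; (ii) $\bar{\mathcal A}$ is eventually $(\mathrm{cl}_n)$-closed; (iii) $\bar{\mathcal A}$ is $(\mathrm{cl}_n)$-closed. Moreover, these equivalent statements hold if $\mathcal A$ is eventually saturated.
   Context: A chain of sets is a sequence $(A_n)_{n\ge1}$ with $A_n\subseteq S_n$, $A_n\subseteq A_{n+1}$; limit $A_\infty=\bigcup_nA_n$; eventually saturated if $A_n=A_\infty\cap S_n$ for all large $n$. A closure operation on $X$: $A\mapsto A^{\mathrm{cl}}$ on subsets with $A\subseteq A^{\mathrm{cl}}$, $(A^{\mathrm{cl}})^{\mathrm{cl}}=A^{\mathrm{cl}}$, monotone; $A$ closed if $A^{\mathrm{cl}}=A$. Consistency: $(A\cap S_n)^{\mathrm{cl}_n}=A^{\mathrm{cl}_\infty}\cap S_n$ for all $n\ge1$ and $A\subseteq S_\infty$. A chain $(B_n)$ is $(\mathrm{cl}_n)$-closed (resp. eventually) if $B_n$ is $\mathrm{cl}_n$-closed for all $n$ (resp. all large $n$). -}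

module Defs where

open import Level using (Level; _⊔_; suc)
open import Data.Nat using (ℕ; _≤_)
open import Data.Nat as ℕ using ()
open import Data.Product using (Σ; ∃; _×_; _,_)
open import Relation.Unary using (Pred; _⊆_; _≐_; _∩_; U)

module _ {a ℓ : Level} {X : Set a} where

  record IsClosureOn {t : Level} (T : Pred X t) (cl : Pred X ℓ → Pred X ℓ)
         : Set (a ⊔ suc ℓ ⊔ t) where
    field
      within    : ∀ A → A ⊆ T → cl A ⊆ T
      extensive : ∀ A → A ⊆ T → A ⊆ cl A
      idem      : ∀ A → A ⊆ T → cl (cl A) ≐ cl A
      mono      : ∀ A B → A ⊆ T → B ⊆ T → A ⊆ B → cl A ⊆ cl B

  Closed : (Pred X ℓ → Pred X ℓ) → Pred X ℓ → Set (a ⊔ ℓ)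
  Closed cl A = cl A ≐ A

  ⋃ : (ℕ → Pred X ℓ) → Pred X ℓ
  ⋃ A = λ x → ∃ λ n → A n x

  IsChain : (S : ℕ → Pred X ℓ) → (ℕ → Pred X ℓ) → Set (a ⊔ ℓ)
  IsChain S A = (∀ n → A n ⊆ S n) × (∀ n → A n ⊆ A (ℕ.suc n))

  limit : (ℕ → Pred X ℓ) → Pred X ℓ
  limit = ⋃

  saturation : (S : ℕ → Pred X ℓ) → (ℕ → Pred X ℓ) → ℕ → Pred X ℓ
  saturation S A n = limit A ∩ S n

  EventuallySaturated : (S : ℕ → Pred X ℓ) → (ℕ → Pred X ℓ) → Set (a ⊔ ℓ)
  EventuallySaturated S A = ∃ λ N → ∀ n → N ≤ n → A n ≐ (limit A ∩ S n)

  ChainClosed : (ℕ → Pred X ℓ → Pred X ℓ) → (ℕ → Pred X ℓ) → Set (a ⊔ ℓ)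
  ChainClosed cl B = ∀ n → Closed (cl n) (B n)

  EventuallyChainClosed : (ℕ → Pred X ℓ → Pred X ℓ) → (ℕ → Pred X ℓ) → Set (a ⊔ ℓ)
  EventuallyChainClosed cl B = ∃ λ N → ∀ n → N ≤ n → Closed (cl n) (B n)

  -- consistent system of closure operations ((cl_n), cl∞) for the filtration S
  -- of S∞ = X:  (A ∩ S n)^{cl n} = A^{cl∞} ∩ S n for all n and all A ⊆ S∞.
  Consistent : (S : ℕ → Pred X ℓ) → (ℕ → Pred X ℓ → Pred X ℓ)
             → (Pred X ℓ → Pred X ℓ) → Set (a ⊔ suc ℓ)
  Consistent S cl cl∞ = ∀ n (A : Pred X ℓ) → cl n (A ∩ S n) ≐ (cl∞ A ∩ S n)

-- Consistency identifies cl∞ B ∩ S n with cl n (B ∩ S n). Every point lies in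
-- S n for all large n, so cl∞ B ⊆ B as soon as cl n (B ∩ S n) ⊆ B for all large
-- n; conversely, if B is cl∞-closed, consistency makes every slice B ∩ S n
-- cl n-closed. For an eventually saturated chain the slices are eventually the
-- closed sets A n themselves, which lie in the limit.
module Submission where

open import Defs
open import Level using (Level)
open import Data.Nat using (ℕ; suc; _≤_; _≤′_; ≤′-refl; ≤′-step; _⊔_)
open import Data.Nat.Properties using (≤⇒≤′; m≤m⊔n; m≤n⊔m)
open import Data.Product using (∃; _×_; _,_; proj₁; proj₂)
open import Relation.Unary using (Pred; _⊆_; _∩_; U)

module _ {a ℓ : Level} {X : Set a} where

  closed-of-⊆ : {cl : Pred X ℓ → Pred X ℓ} {B : Pred X ℓ} →
                IsClosureOn U cl → cl B ⊆ B → Closed cl B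
  closed-of-⊆ {B = B} isClosure cl⊆ = cl⊆ , IsClosureOn.extensive isClosure B _

  module _ {S : ℕ → Pred X ℓ} (S-step : ∀ n → S n ⊆ S (suc n)) where

    S-mono : ∀ {m n} → m ≤ n → S m ⊆ S n
    S-mono m≤n = go (≤⇒≤′ m≤n)
      where
      go : ∀ {m n} → m ≤′ n → S m ⊆ S n
      go ≤′-refl        = λ x∈ → x∈
      go (≤′-step m≤′n) = λ x∈ → S-step _ (go m≤′n x∈)

    eventually-∈-S : (∀ x → ∃ λ n → S n x) → ∀ x N → ∃ λ n → N ≤ n × S n x
    eventually-∈-S cover x N with cover x
    ... | k , x∈Sk = k ⊔ N , m≤n⊔m k N , S-mono (m≤m⊔n k N) x∈Sk

    module Consistency (cover : ∀ x → ∃ λ n → S n x)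
             {cl : ℕ → Pred X ℓ → Pred X ℓ} {cl∞ : Pred X ℓ → Pred X ℓ}
             (consistent : Consistent S cl cl∞) where

      cl∞-⊆-of-eventual-slices : ∀ {B} N → (∀ n → N ≤ n → cl n (B ∩ S n) ⊆ B) →
                                 cl∞ B ⊆ B
      cl∞-⊆-of-eventual-slices {B} N slice⊆ {x} x∈clB with eventually-∈-S cover x N
      ... | n , N≤n , x∈Sn = slice⊆ n N≤n (proj₂ (consistent n B) (x∈clB , x∈Sn))

      slice-closed : ∀ {B} → Closed cl∞ B → ∀ n → Closed (cl n) (B ∩ S n)
      slice-closed {B} (clB⊆B , B⊆clB) n =
          (λ x∈ → let x∈clB , x∈Sn = proj₁ (consistent n B) x∈ in clB⊆B x∈clB , x∈Sn)
        , (λ { (x∈B , x∈Sn) → proj₂ (consistent n B) (B⊆clB x∈B , x∈Sn) })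

      closed-of-eventually-closed-slices :
        ∀ {B} → IsClosureOn U cl∞ →
        EventuallyChainClosed cl (λ n → B ∩ S n) → Closed cl∞ B
      closed-of-eventually-closed-slices isClosure∞ (N , closedFrom) =
        closed-of-⊆ isClosure∞ (cl∞-⊆-of-eventual-slices N
          λ n N≤n x∈ → proj₁ (proj₁ (closedFrom n N≤n) x∈))

      limit-closed-of-eventually-saturated :
        ∀ {A} → (∀ n → IsClosureOn (S n) (cl n)) → IsClosureOn U cl∞ →
        IsChain S A → ChainClosed cl A → EventuallySaturated S A →
        Closed cl∞ (limit A)
      limit-closed-of-eventually-saturated {A} isClosure isClosure∞
        (A⊆S , _) A-closed (N , saturated) =
        closed-of-⊆ isClosure∞ (cl∞-⊆-of-eventual-slices N slice⊆)
        where
        slice⊆ : ∀ n → N ≤ n → cl n (limit A ∩ S n) ⊆ limit A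
        slice⊆ n N≤n x∈ =
          n , proj₁ (A-closed n)
                (IsClosureOn.mono (isClosure n) (limit A ∩ S n) (A n)
                   proj₂ (A⊆S n) (proj₂ (saturated n N≤n)) x∈)

lemma2p7 : {a ℓ : Level} {X : Set a}
    (S : ℕ → Pred X ℓ)
    → (∀ n → S n ⊆ S (suc n))
    → (∀ x → ∃ λ n → S n x)
    → (cl : ℕ → Pred X ℓ → Pred X ℓ) (cl∞ : Pred X ℓ → Pred X ℓ)
    → (∀ n → IsClosureOn (S n) (cl n))
    → IsClosureOn U cl∞
    → Consistent S cl cl∞
    → (A : ℕ → Pred X ℓ)
    → IsChain S A
    → ChainClosed cl A
    → ((Closed cl∞ (limit A) → EventuallyChainClosed cl (saturation S A))
    × (EventuallyChainClosed cl (saturation S A) → ChainClosed cl (saturation S A))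
    × (ChainClosed cl (saturation S A) → Closed cl∞ (limit A)))
    × (EventuallySaturated S A → Closed cl∞ (limit A))
lemma2p7 S S-step cover cl cl∞ isClosure isClosure∞ consistent A chain A-closed =
    (i⇒ii , ii⇒iii , iii⇒i)
  , limit-closed-of-eventually-saturated isClosure isClosure∞ chain A-closed
  where
  open Consistency S-step cover {cl = cl} {cl∞} consistent

  ii⇒i : EventuallyChainClosed cl (saturation S A) → Closed cl∞ (limit A)
  ii⇒i = closed-of-eventually-closed-slices isClosure∞

  i⇒iii : Closed cl∞ (limit A) → ChainClosed cl (saturation S A)
  i⇒iii = slice-closed

  i⇒ii : Closed cl∞ (limit A) → EventuallyChainClosed cl (saturation S A)
  i⇒ii closed = 0 , λ n _ → i⇒iii closed n

  ii⇒iii : EventuallyChainClosed cl (saturation S A) → ChainClosed cl (saturation S A)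
  ii⇒iii eventually = i⇒iii (ii⇒i eventually)

  iii⇒i : ChainClosed cl (saturation S A) → Closed cl∞ (limit A)
  iii⇒i closed = ii⇒i (0 , λ n _ → closed n)
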